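{- Let $k$ be a positive integer, let $c(n,k)$ be defined by $(1-k^2x)^{ -1/k}=\sum_{n\ge 0}c(n,k)x^n$, and let $p$ be a prime dividing $k$. Then for every $n\ge 0$, $$\nu_p(c(n,k))=\nu_p(k)\,n-\frac{n-s_p(n)}{p-1}.$$
   Context: $\nu_p(m)$ denotes the exponent of the highest power of $p$ dividing the integer $m$. $s_p(n)$ denotes the sum of the digits of $n$ in base $p$. -}

module Defs where

open import Data.Nat as ℕ using (ℕ; zero; suc; NonZero)
open import Data.Nat.DivMod using (_%_; _/_)
open import Data.Integer as ℤ using (ℤ; +_)
open import Data.Rational as ℚ using (ℚ; 0ℚ; 1ℚ; _+_; _*_; _-_; -_)

_^ℚ_ : ℚ → ℕ → ℚ
q ^ℚ zero = 1ℚ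
q ^ℚ suc n = q * (q ^ℚ n)

nℚ : ℕ → ℚ
nℚ n = (+ n) ℚ./ 1

gbinom : ℚ → ℕ → ℚ
gbinom a zero = 1ℚ
gbinom a (suc n) = gbinom a n * ((a - nℚ n) * ((+ 1) ℚ./ suc n))

-- c(n,k) = coefficient of x^n in (1 - k^2 x)^(-1/k)
--        = binom(-1/k, n) * (-k^2)^n   (generalized binomial theorem)
c : (n k : ℕ) → .{{NonZero k}} → ℚ
c n k = gbinom (- ((+ 1) ℚ./ k)) n * ((- nℚ (k ℕ.* k)) ^ℚ n)

-- sum of base-b digits of n, with fuel (fuel n suffices for b ≥ 2)
digitSumF : ℕ → ℕ → ℕ → ℕ
digitSumF zero b n = 0
digitSumF (suc f) zero n = n
digitSumF (suc f) (suc zero) n = n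
digitSumF (suc f) (suc (suc q)) n = n % suc (suc q) ℕ.+ digitSumF f (suc (suc q)) (n / suc (suc q))

s : ℕ → ℕ → ℕ
s p n = digitSumF n p n

-- m / (p - 1), for p ≥ 2 (returns 0 for the irrelevant cases p ≤ 1)
divByPred : ℕ → ℕ → ℕ
divByPred m zero = 0
divByPred m (suc zero) = 0
divByPred m (suc (suc q)) = m / suc q

module Submission where

-- Write the prime as p = t + 2 and k = m·p^v with p ∤ m; then v ≥ 1 since p ∣ k.
-- The proof combines three facts.
--   1. Closed form.  c(n+1,k) = c(n,k) · (1 + nk)k/(n+1), hence
--        c(n,k) = k^n · R(n) / n!   with   R(n) = ∏_{j<n} (1 + jk).
--   2. Units.  As p ∣ k, every factor 1 + jk is prime to p, so the numerator is
--      p^{vn} times the number m^n · R(n), which is prime to p.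
--   3. Legendre's formula.  n! = p^E · u with p ∤ u and E(p-1) + s_p(n) = n,
--      proved by strong induction on n = r + qp, using (r + qp)! = p^q · q! · (unit).
-- Since E ≤ n ≤ vn, cancelling p^E gives c(n,k) = p^{vn-E} · (unit)/(unit), and
-- (n - s_p(n))/(p - 1) = E is exactly the exponent in the statement.

open import Defs
open import Data.Nat as ℕ using (ℕ; suc; NonZero; _∸_; _^_)
open import Data.Nat.Divisibility using (_∣_)
open import Data.Nat.Primality using (Prime)
open import Data.Integer as ℤ using (ℤ; +_; ∣_∣)
open import Data.Rational as ℚ using (ℚ)
open import Data.Product using (Σ; _×_)
open import Relation.Nullary using (¬_)
open import Relation.Binary.PropositionalEquality using (_≡_)

open import Data.Nat using (zero; _+_; _*_; _≤_; _<_; s≤s; z≤n; _!)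
open import Data.Nat.Properties
open import Data.Nat.DivMod using (_/_; _%_; m≡m%n+[m/n]*n; m%n<n; m*n/n≡m; m/n<m)
open import Data.Nat.Divisibility using (divides; _∣0; ∣m+n∣m⇒∣n; n∣m*n; ∣1⇒≡1; ∣⇒≤; ∣-trans)
open import Data.Nat.Primality using (euclidsLemma; ¬prime[0]; ¬prime[1])
open import Data.Nat.Induction using (<-rec)
open import Data.Nat.Tactic.RingSolver using (solve-∀)
open import Data.Product using (∃-syntax; _,_)
open import Data.Sum using (inj₁; inj₂)
open import Data.Empty using (⊥-elim)
open import Relation.Binary.PropositionalEquality using (refl; sym; trans; cong; cong₂; subst; module ≡-Reasoning)
import Data.Rational.Properties as ℚP
import Data.Rational.Unnormalised as ℚᵘ
import Data.Rational.Unnormalised.Properties as ℚᵘP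
open import Data.Rational.Solver using (module +-*-Solver)
import Data.Integer.Properties as ℤP

open ≡-Reasoning

frac : (a b : ℕ) → .{{NonZero b}} → ℚ
frac a b = (+ a) ℚ./ b

frac-cong : ∀ a b c d .{{_ : NonZero b}} .{{_ : NonZero d}} →
            a * d ≡ c * b → frac a b ≡ frac c d
frac-cong a zero    c d {{()}}
frac-cong a (suc b) c zero {{_}} {{()}}
frac-cong a (suc b) c (suc d) ad≡cb =
  ℚP.fromℚᵘ-cong {ℚᵘ.mkℚᵘ (+ a) b} {ℚᵘ.mkℚᵘ (+ c) d} (ℚᵘ.*≡* (begin
    + a ℤ.* + suc d ≡⟨ ℤP.pos-* a (suc d) ⟨
    + (a * suc d)   ≡⟨ cong +_ ad≡cb ⟩
    + (c * suc b)   ≡⟨ ℤP.pos-* c (suc b) ⟩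
    + c ℤ.* + suc b ∎))

-- frac a (b+1) is the normalisation of the unnormalised fraction a/(b+1); the
-- next two lemmas move between the two forms, so that sums and products of
-- fractions can be computed in ℚᵘ, where they are given by the usual formulas.
toℚᵘ-frac : ∀ a b → ℚ.toℚᵘ (frac a (suc b)) ℚᵘ.≃ ℚᵘ.mkℚᵘ (+ a) b
toℚᵘ-frac a b = ℚP.toℚᵘ-fromℚᵘ (ℚᵘ.mkℚᵘ (+ a) b)

≡frac : ∀ q a b → ℚ.toℚᵘ q ℚᵘ.≃ ℚᵘ.mkℚᵘ (+ a) b → q ≡ frac a (suc b)
≡frac q a b q≃a/b = trans (sym (ℚP.fromℚᵘ-toℚᵘ q)) (ℚP.fromℚᵘ-cong q≃a/b)

frac-* : ∀ a b c d .{{_ : NonZero b}} .{{_ : NonZero d}} →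
         frac a b ℚ.* frac c d ≡ frac (a * c) (b * d) {{m*n≢0 b d}}
frac-* a zero    c d {{()}}
frac-* a (suc b) c zero {{_}} {{()}}
frac-* a (suc b) c (suc d) =
  ≡frac _ (a * c) (d + b * suc d)
    (ℚᵘP.≃-trans (ℚP.toℚᵘ-homo-* (frac a (suc b)) (frac c (suc d)))
    (ℚᵘP.≃-trans (ℚᵘP.*-cong (toℚᵘ-frac a b) (toℚᵘ-frac c d))
                 (ℚᵘ.*≡* (cong (ℤ._* + (suc b * suc d)) (sym (ℤP.pos-* a c))))))

frac-+ : ∀ a b c d .{{_ : NonZero b}} .{{_ : NonZero d}} →
         frac a b ℚ.+ frac c d ≡ frac (a * d + c * b) (b * d) {{m*n≢0 b d}}
frac-+ a zero    c d {{()}}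
frac-+ a (suc b) c zero {{_}} {{()}}
frac-+ a (suc b) c (suc d) =
  ≡frac _ (a * suc d + c * suc b) (d + b * suc d)
    (ℚᵘP.≃-trans (ℚP.toℚᵘ-homo-+ (frac a (suc b)) (frac c (suc d)))
    (ℚᵘP.≃-trans (ℚᵘP.+-cong (toℚᵘ-frac a b) (toℚᵘ-frac c d))
                 (ℚᵘ.*≡* (cong (ℤ._* + (suc b * suc d)) numerator))))
  where
  numerator : + a ℤ.* + suc d ℤ.+ + c ℤ.* + suc b ≡ + (a * suc d + c * suc b)
  numerator = begin
    + a ℤ.* + suc d ℤ.+ + c ℤ.* + suc b ≡⟨ cong₂ ℤ._+_ (ℤP.pos-* a (suc d)) (ℤP.pos-* c (suc b)) ⟨
    + (a * suc d) ℤ.+ + (c * suc b)     ≡⟨ ℤP.pos-+ (a * suc d) (c * suc b) ⟨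
    + (a * suc d + c * suc b)           ∎

^-distrib-* : ∀ a b n → (a * b) ^ n ≡ a ^ n * b ^ n
^-distrib-* a b zero    = refl
^-distrib-* a b (suc n) = begin
  a * b * (a * b) ^ n     ≡⟨ cong (a * b *_) (^-distrib-* a b n) ⟩
  a * b * (a ^ n * b ^ n) ≡⟨ swap a b (a ^ n) (b ^ n) ⟩
  a * a ^ n * (b * b ^ n) ∎
  where
  swap : ∀ w x y z → w * x * (y * z) ≡ w * y * (x * z)
  swap = solve-∀

module _ {p : ℕ} (p-prime : Prime p) where

  prime∤1 : ¬ p ∣ 1
  prime∤1 p∣1 = ¬prime[1] (subst Prime (∣1⇒≡1 p∣1) p-prime)

  prime∤-* : ∀ {x y} → ¬ p ∣ x → ¬ p ∣ y → ¬ p ∣ x * y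
  prime∤-* {x} {y} p∤x p∤y p∣xy with euclidsLemma x y p-prime p∣xy
  ... | inj₁ p∣x = p∤x p∣x
  ... | inj₂ p∣y = p∤y p∣y

  prime∤-^ : ∀ {x} n → ¬ p ∣ x → ¬ p ∣ x ^ n
  prime∤-^ zero    p∤x = prime∤1
  prime∤-^ (suc n) p∤x = prime∤-* p∤x (prime∤-^ n p∤x)

  prime∤1+jk : ∀ {k} j → p ∣ k → ¬ p ∣ 1 + j * k
  prime∤1+jk {k} j p∣k p∣1+jk =
    prime∤1 (∣m+n∣m⇒∣n (subst (p ∣_) (+-comm 1 (j * k)) p∣1+jk) (∣-trans p∣k (n∣m*n j)))

exactPower-cofactor : ∀ {p v k m} → k ≡ m * p ^ v → ¬ p ^ suc v ∣ k → ¬ p ∣ m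
exactPower-cofactor {p} {v} {k} {m} k≡mpᵛ pᵛ⁺¹∤k (divides j m≡jp) =
  pᵛ⁺¹∤k (divides j (begin
    k               ≡⟨ k≡mpᵛ ⟩
    m * p ^ v       ≡⟨ cong (_* p ^ v) m≡jp ⟩
    j * p * p ^ v   ≡⟨ *-assoc j p (p ^ v) ⟩
    j * p ^ suc v   ∎))

exactPower-^ : ∀ {p v k m} → k ≡ m * p ^ v → ∀ n → k ^ n ≡ m ^ n * p ^ (v * n)
exactPower-^ {p} {v} {k} {m} k≡mpᵛ n = begin
  k ^ n               ≡⟨ cong (_^ n) k≡mpᵛ ⟩
  (m * p ^ v) ^ n     ≡⟨ ^-distrib-* m (p ^ v) n ⟩
  m ^ n * (p ^ v) ^ n ≡⟨ cong (m ^ n *_) (^-*-assoc p v n) ⟩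
  m ^ n * p ^ (v * n) ∎

exactPower-positive : ∀ {p v k} → p ∣ k → ¬ p ^ suc v ∣ k → NonZero v
exactPower-positive {p} {zero}  p∣k p¹∤k = ⊥-elim (p¹∤k (subst (_∣ _) (sym (*-identityʳ p)) p∣k))
exactPower-positive {p} {suc v} p∣k pᵛ⁺¹∤k = _

-- Digit sums and Legendre's formula in base p = t + 2; the base is written as
-- suc (suc t) so that the digit sum s p unfolds by computation.
module Legendre (t : ℕ) where

  p : ℕ
  p = suc (suc t)

  quotient≤ : ∀ m → suc m / p ≤ m
  quotient≤ m = ≤-pred (m/n<m (suc m) p (s≤s (s≤s z≤n)))

  digitSum-zero : ∀ f → digitSumF f p 0 ≡ 0
  digitSum-zero zero    = refl
  digitSum-zero (suc f) = digitSum-zero f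

  digitSum-fuel : ∀ f g n → n ≤ f → n ≤ g → digitSumF f p n ≡ digitSumF g p n
  digitSum-fuel f       g       zero    _         _         = trans (digitSum-zero f) (sym (digitSum-zero g))
  digitSum-fuel (suc f) (suc g) (suc m) (s≤s m≤f) (s≤s m≤g) =
    cong (_+_ (suc m % p))
      (digitSum-fuel f g (suc m / p) (≤-trans (quotient≤ m) m≤f) (≤-trans (quotient≤ m) m≤g))

  s-lastDigit : ∀ n → s p n ≡ n % p + s p (n / p)
  s-lastDigit zero    = refl
  s-lastDigit (suc m) =
    cong (_+_ (suc m % p)) (digitSum-fuel m (suc m / p) (suc m / p) (quotient≤ m) ≤-refl)

  divByPred-legendre : ∀ n E → E * suc t + s p n ≡ n → divByPred (n ∸ s p n) p ≡ E
  divByPred-legendre n E legendre = begin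
    (n ∸ s p n) / suc t                      ≡⟨ cong (λ x → (x ∸ s p n) / suc t) legendre ⟨
    (E * suc t + s p n ∸ s p n) / suc t      ≡⟨ cong (_/ suc t) (m+n∸n≡m (E * suc t) (s p n)) ⟩
    E * suc t / suc t                        ≡⟨ m*n/n≡m E (suc t) ⟩
    E                                        ∎

  exponent≤ : ∀ n E → E * suc t + s p n ≡ n → E ≤ n
  exponent≤ n E legendre =
    ≤-trans (m≤m*n E (suc t)) (subst (E * suc t ≤_) legendre (m≤m+n (E * suc t) (s p n)))

  record FactorialSplit (n : ℕ) : Set where
    field
      exponent : ℕ
      cofactor : ℕ
      splits   : n ! ≡ p ^ exponent * cofactor
      coprime  : ¬ p ∣ cofactor
      legendre : exponent * suc t + s p n ≡ n

  module _ (p-prime : Prime p) where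

    -- In (r + qp)! with r < p only the multiples p, 2p, …, qp contribute p's:
    -- (r + qp)! = p^q · q! · F with p ∤ F.
    factorial-block : ∀ q r → r < p → ∃[ F ] (r + q * p) ! ≡ p ^ q * (q ! * F) × ¬ p ∣ F
    factorial-block zero    zero    _ = 1 , refl , prime∤1 p-prime
    -- The block ends at the multiple (q+1)p, which contributes p · (q+1).
    factorial-block (suc q) zero    _ with factorial-block q (suc t) ≤-refl
    ... | F , splits , p∤F =
      F , trans (cong (suc (suc (t + q * p)) *_) splits) (multiple t q (p ^ q) (q !) F) , p∤F
      where
      multiple : ∀ t q a b F → suc (suc (t + q * suc (suc t))) * (a * (b * F))
                                ≡ (suc (suc t) * a) * ((suc q * b) * F)
      multiple = solve-∀
    -- A non-multiple r + 1 + qp of p only enlarges the unit F.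
    factorial-block q (suc r) r+1<p with factorial-block q r (<⇒≤ r+1<p)
    ... | F , splits , p∤F =
      (suc r + q * p) * F ,
      trans (cong (suc (r + q * p) *_) splits) (nonMultiple (r + q * p) (p ^ q) (q !) F) ,
      prime∤-* p-prime p∤r+1+qp p∤F
      where
      nonMultiple : ∀ x a b F → suc x * (a * (b * F)) ≡ a * (b * (suc x * F))
      nonMultiple = solve-∀
      p∤r+1+qp : ¬ p ∣ suc r + q * p
      p∤r+1+qp p∣ =
        <⇒≱ r+1<p (∣⇒≤ (∣m+n∣m⇒∣n (subst (p ∣_) (+-comm (suc r) (q * p)) p∣) (n∣m*n q)))

    -- Legendre's formula, by strong induction: n! = (r + qp)! = p^q · q! · F.
    factorialSplit : ∀ n → FactorialSplit n
    factorialSplit = <-rec FactorialSplit step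
      where
      step : ∀ n → (∀ {m} → m < n → FactorialSplit m) → FactorialSplit n
      step zero    _  = record { exponent = 0 ; cofactor = 1 ; splits = refl
                               ; coprime = prime∤1 p-prime ; legendre = refl }
      step (suc m) ih with ih (s≤s (quotient≤ m)) | factorial-block (suc m / p) (suc m % p) (m%n<n (suc m) p)
      ... | record { exponent = E ; cofactor = u ; splits = q!≡ ; coprime = p∤u ; legendre = legendreq }
          | F , block , p∤F =
        record { exponent = q + E ; cofactor = u * F ; splits = splits
               ; coprime = prime∤-* p-prime p∤u p∤F ; legendre = legendre }
        where
        q = suc m / p
        r = suc m % p
        splits : suc m ! ≡ p ^ (q + E) * (u * F)
        splits = begin
          suc m !                ≡⟨ cong _! (m≡m%n+[m/n]*n (suc m) p) ⟩
          (r + q * p) !          ≡⟨ block ⟩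
          p ^ q * (q ! * F)      ≡⟨ cong (λ x → p ^ q * (x * F)) q!≡ ⟩
          p ^ q * (p ^ E * u * F) ≡⟨ cong (p ^ q *_) (*-assoc (p ^ E) u F) ⟩
          p ^ q * (p ^ E * (u * F)) ≡⟨ *-assoc (p ^ q) (p ^ E) (u * F) ⟨
          p ^ q * p ^ E * (u * F) ≡⟨ cong (_* (u * F)) (^-distribˡ-+-* p q E) ⟨
          p ^ (q + E) * (u * F)  ∎
        regroup : ∀ q E t r S → (q + E) * suc t + (r + S) ≡ q * suc t + r + (E * suc t + S)
        regroup = solve-∀
        division : ∀ q t r → q * suc t + r + q ≡ r + q * suc (suc t)
        division = solve-∀
        legendre : (q + E) * suc t + s p (suc m) ≡ suc m
        legendre = begin
          (q + E) * suc t + s p (suc m)          ≡⟨ cong (_+_ ((q + E) * suc t)) (s-lastDigit (suc m)) ⟩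
          (q + E) * suc t + (r + s p q)          ≡⟨ regroup q E t r (s p q) ⟩
          q * suc t + r + (E * suc t + s p q)    ≡⟨ cong (_+_ (q * suc t + r)) legendreq ⟩
          q * suc t + r + q                      ≡⟨ division q t r ⟩
          r + q * p                              ≡⟨ m≡m%n+[m/n]*n (suc m) p ⟨
          suc m                                  ∎

risingProduct : ℕ → ℕ → ℕ
risingProduct k zero    = 1
risingProduct k (suc n) = (1 + n * k) * risingProduct k n

prime∤risingProduct : ∀ {p k} → Prime p → p ∣ k → ∀ n → ¬ p ∣ risingProduct k n
prime∤risingProduct p-prime p∣k zero    = prime∤1 p-prime
prime∤risingProduct p-prime p∣k (suc n) =
  prime∤-* p-prime (prime∤1+jk p-prime n p∣k) (prime∤risingProduct p-prime p∣k n)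

module ClosedForm (k : ℕ) .{{_ : NonZero k}} where

  ratio : ∀ n → ((+ 1) ℚ./ k ℚ.+ nℚ n) ℚ.* nℚ (k * k) ℚ.* frac 1 (suc n)
                ≡ frac ((1 + n * k) * k) (suc n)
  ratio n = begin
    (frac 1 k ℚ.+ frac n 1) ℚ.* frac (k * k) 1 ℚ.* frac 1 (suc n)
      ≡⟨ cong (λ x → x ℚ.* frac (k * k) 1 ℚ.* frac 1 (suc n)) (frac-+ 1 k n 1) ⟩
    frac (1 * 1 + n * k) (k * 1) ℚ.* frac (k * k) 1 ℚ.* frac 1 (suc n)
      ≡⟨ cong (ℚ._* frac 1 (suc n)) (frac-* (1 * 1 + n * k) (k * 1) (k * k) 1) ⟩
    frac ((1 * 1 + n * k) * (k * k)) (k * 1 * 1) ℚ.* frac 1 (suc n)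
      ≡⟨ frac-* ((1 * 1 + n * k) * (k * k)) (k * 1 * 1) 1 (suc n) ⟩
    frac ((1 * 1 + n * k) * (k * k) * 1) (k * 1 * 1 * suc n)
      ≡⟨ frac-cong ((1 * 1 + n * k) * (k * k) * 1) (k * 1 * 1 * suc n) ((1 + n * k) * k) (suc n) (cross n k) ⟩
    frac ((1 + n * k) * k) (suc n) ∎
    where
    instance
      k*1≢0 : NonZero (k * 1)
      k*1≢0 = m*n≢0 k 1
      k*1*1≢0 : NonZero (k * 1 * 1)
      k*1*1≢0 = m*n≢0 (k * 1) 1
      k*1*1*[n+1]≢0 : NonZero (k * 1 * 1 * suc n)
      k*1*1*[n+1]≢0 = m*n≢0 (k * 1 * 1) (suc n)
    cross : ∀ n k → (1 * 1 + n * k) * (k * k) * 1 * suc n ≡ (1 + n * k) * k * (k * 1 * 1 * suc n)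
    cross = solve-∀

  c-suc : ∀ n → c (suc n) k ≡ c n k ℚ.* frac ((1 + n * k) * k) (suc n)
  c-suc n = trans (expand (gbinom (ℚ.- ((+ 1) ℚ./ k)) n) ((ℚ.- nℚ (k * k)) ^ℚ n)
                          ((+ 1) ℚ./ k) (nℚ n) (nℚ (k * k)) ((+ 1) ℚ./ suc n))
                  (cong (c n k ℚ.*_) (ratio n))
    where
    open +-*-Solver
    expand : ∀ (G W u m K v : ℚ) →
             (G ℚ.* ((ℚ.- u ℚ.- m) ℚ.* v)) ℚ.* (ℚ.- K ℚ.* W)
             ≡ (G ℚ.* W) ℚ.* ((u ℚ.+ m) ℚ.* K ℚ.* v)
    expand = solve 6 (λ G W u m K v →
               (G :* ((:- u :- m) :* v)) :* (:- K :* W) := (G :* W) :* ((u :+ m) :* K :* v)) refl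

  c-closedForm : ∀ n → c n k ≡ frac (k ^ n * risingProduct k n) (n !) {{n !≢0}}
  c-closedForm zero    = refl
  c-closedForm (suc n) = begin
    c (suc n) k
      ≡⟨ c-suc n ⟩
    c n k ℚ.* frac ((1 + n * k) * k) (suc n)
      ≡⟨ cong (ℚ._* frac ((1 + n * k) * k) (suc n)) (c-closedForm n) ⟩
    frac (k ^ n * R) (n !) ℚ.* frac ((1 + n * k) * k) (suc n)
      ≡⟨ frac-* (k ^ n * R) (n !) ((1 + n * k) * k) (suc n) ⟩
    frac (k ^ n * R * ((1 + n * k) * k)) (n ! * suc n)
      ≡⟨ frac-cong (k ^ n * R * ((1 + n * k) * k)) (n ! * suc n) (k ^ suc n * risingProduct k (suc n)) (suc n !)
           (cross n k (k ^ n) R (n !)) ⟩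
    frac (k ^ suc n * risingProduct k (suc n)) (suc n !) ∎
    where
    instance
      n!≢0 : NonZero (n !)
      n!≢0 = n !≢0
      n!*[n+1]≢0 : NonZero (n ! * suc n)
      n!*[n+1]≢0 = m*n≢0 (n !) (suc n)
      [n+1]!≢0 : NonZero (suc n !)
      [n+1]!≢0 = suc n !≢0
    R = risingProduct k n
    cross : ∀ n k kⁿ R n! → kⁿ * R * ((1 + n * k) * k) * (suc n * n!)
                            ≡ k * kⁿ * ((1 + n * k) * R) * (n! * suc n)
    cross = solve-∀

-- The theorem for the prime p = t + 2 and k = m·p^v with p ∤ m and v ≥ 1:
-- with n! = p^E · u, the closed form becomes p^(vn-E) · (m^n · R) / u.
c-valuation : ∀ t → Prime (suc (suc t)) → (k : ℕ) .{{_ : NonZero k}} → (m v : ℕ) →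
  k ≡ m * suc (suc t) ^ v → ¬ suc (suc t) ∣ m → .{{NonZero v}} → suc (suc t) ∣ k → (n : ℕ) →
  Σ ℤ λ a → Σ ℕ λ b → ¬ (suc (suc t) ∣ ∣ a ∣) × ¬ (suc (suc t) ∣ suc b) ×
    (c n k ≡ ((ℤ.+ (suc (suc t) ^ ((v ℕ.* n) ∸ divByPred (n ∸ s (suc (suc t)) n) (suc (suc t)))))
               ℤ.* a) ℚ./ suc b)
c-valuation t p-prime k m v k≡mpᵛ p∤m p∣k n with Legendre.factorialSplit t p-prime n
... | record { cofactor = zero ; coprime = p∤0 } = ⊥-elim (p∤0 (_ ∣0))
... | record { exponent = E ; cofactor = suc b ; splits = n!≡ ; coprime = p∤u ; legendre = legendre }
    rewrite Legendre.divByPred-legendre t n E legendre =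
  + A , b , prime∤-* p-prime (prime∤-^ p-prime n p∤m) (prime∤risingProduct p-prime p∣k n) , p∤u ,
  (begin
    c n k                             ≡⟨ ClosedForm.c-closedForm k n ⟩
    frac (k ^ n * R) (n !) {{n !≢0}}  ≡⟨ frac-cong (k ^ n * R) (n !) (p ^ δ * A) (suc b) {{n !≢0}} cross ⟩
    frac (p ^ δ * A) (suc b)          ≡⟨ cong (ℚ._/ suc b) (ℤP.pos-* (p ^ δ) A) ⟩
    (+ (p ^ δ) ℤ.* + A) ℚ./ suc b     ∎)
  where
  p = suc (suc t)
  R = risingProduct k n
  A = m ^ n * R
  δ = v * n ∸ E
  vn≡E+δ : v * n ≡ E + δ
  vn≡E+δ = sym (m+[n∸m]≡n (≤-trans (Legendre.exponent≤ t n E legendre) (m≤n*m n v)))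
  regroup : ∀ mⁿ pᴱ pᵟ R b → mⁿ * (pᴱ * pᵟ) * R * b ≡ pᵟ * (mⁿ * R) * (pᴱ * b)
  regroup = solve-∀
  cross : k ^ n * R * suc b ≡ p ^ δ * A * n !
  cross = begin
    k ^ n * R * suc b                    ≡⟨ cong (λ x → x * R * suc b) (exactPower-^ {p = p} {v} k≡mpᵛ n) ⟩
    m ^ n * p ^ (v * n) * R * suc b      ≡⟨ cong (λ x → m ^ n * p ^ x * R * suc b) vn≡E+δ ⟩
    m ^ n * p ^ (E + δ) * R * suc b      ≡⟨ cong (λ x → m ^ n * x * R * suc b) (^-distribˡ-+-* p E δ) ⟩
    m ^ n * (p ^ E * p ^ δ) * R * suc b  ≡⟨ regroup (m ^ n) (p ^ E) (p ^ δ) R (suc b) ⟩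
    p ^ δ * A * (p ^ E * suc b)          ≡⟨ cong ((p ^ δ * A) *_) n!≡ ⟨
    p ^ δ * A * n !                      ∎

proposition3p1 : (k : ℕ) → .{{_ : NonZero k}} → (p : ℕ) → Prime p → p ∣ k →
  (v : ℕ) → p ^ v ∣ k → ¬ (p ^ suc v ∣ k) →
  (n : ℕ) →
  Σ ℤ λ a → Σ ℕ λ b → ¬ (p ∣ ∣ a ∣) × ¬ (p ∣ suc b) ×
    (c n k ≡ ((ℤ.+ (p ^ ((v ℕ.* n) ∸ divByPred (n ∸ s p n) p))) ℤ.* a) ℚ./ suc b)
proposition3p1 k zero          p-prime = ⊥-elim (¬prime[0] p-prime)
proposition3p1 k (suc zero)    p-prime = ⊥-elim (¬prime[1] p-prime)
proposition3p1 k (suc (suc t)) p-prime p∣k v (divides m k≡mpᵛ) pᵛ⁺¹∤k =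
  c-valuation t p-prime k m v k≡mpᵛ (exactPower-cofactor {v = v} k≡mpᵛ pᵛ⁺¹∤k)
    {{exactPower-positive p∣k pᵛ⁺¹∤k}} p∣k
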